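{- Let $c > 0$ and $b \geq 2$ be integers. Let $S_{[c,b]}:\mathbb{Z}^+\to\mathbb{Z}^+$ be defined by $S_{[c,b]}\left(\sum_{i=0}^n a_i b^i\right) = c + \sum_{i=0}^n a_i^2$ (base $b$ expansion, $0\le a_i\le b-1$, $a_n\ne0$), let $\mathcal{F}^{(1)}_{[c,b]} = \{a = ub \mid 0 < u < b \text{ and } S_{[c,b]}(a) = a\}$, and for an integer $m$ let $r_2(m) = |\{(x,y)\in\mathbb{Z}^2 \mid x^2+y^2 = m\}|$. Then the number of two-digit (in base $b$) fixed points of $S_{[c,b]}$ is \[ \begin{cases} \tfrac{1}{2} r_2(b^2 - 4c + 1) + \left|\mathcal{F}^{(1)}_{[c,b]}\right| & \text{if } b \text{ is odd},\\[0.5em] \tfrac{1}{4} r_2(b^2 - 4c + 1) + \left|\mathcal{F}^{(1)}_{[c,b]}\right| & \text{if } b \text{ is even}.\end{cases} \]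
   Context: A fixed point of $S_{[c,b]}$ is a positive integer $a$ with $S_{[c,b]}(a)=a$; a two-digit number in base $b$ is an integer $a$ with $b \le a < b^2$. -}

module Defs where

open import Data.Nat using (ℕ; zero; suc; _+_; _*_; _∸_; _≟_)
open import Data.Nat.DivMod using (_/_; _%_)
open import Data.Nat.ListAction using (sum)
open import Data.List using (List; []; _∷_; map; length; filter; applyUpTo; upTo; cartesianProduct; _++_)
open import Data.Product using (_,_)
open import Data.Integer as ℤ using (ℤ; +_; -[1+_]; ∣_∣)

-- Base-b digits of n (least significant first), for b ≥ 2.
-- The fuel argument (initialised to n) is always sufficient since n / b < n.
-- For b = 0 the value is irrelevant (the theorem assumes b ≥ 2).
digitsAux : ℕ → ℕ → ℕ → List ℕ
digitsAux zero    b       n       = []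
digitsAux (suc f) zero    n       = []
digitsAux (suc f) (suc b) zero    = []
digitsAux (suc f) (suc b) (suc n) = (suc n % suc b) ∷ digitsAux f (suc b) (suc n / suc b)

digits : ℕ → ℕ → List ℕ
digits b n = digitsAux n b n

S : ℕ → ℕ → ℕ → ℕ
S c b a = c + sum (map (λ d → d * d) (digits b a))

twoDigitFixedCount : ℕ → ℕ → ℕ
twoDigitFixedCount c b =
  length (filter (λ a → S c b a ≟ a) (applyUpTo (λ i → b + i) (b * b ∸ b)))

F1count : ℕ → ℕ → ℕ
F1count c b =
  length (filter (λ u → S c b (u * b) ≟ u * b) (applyUpTo suc (b ∸ 1)))

intRange : ℕ → List ℤ
intRange K = map +_ (upTo (suc K)) ++ map -[1+_] (upTo K)

-- r₂(m) = #{(x,y) ∈ ℤ² | x² + y² = m}.  Any solution satisfies |x|,|y| ≤ |m|,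
-- so it suffices to enumerate the box [-|m|, |m|]².
r2 : ℤ → ℕ
r2 m = length (filter (λ { (x , y) → (x ℤ.* x ℤ.+ y ℤ.* y) ℤ.≟ m })
                      (cartesianProduct (intRange ∣ m ∣) (intRange ∣ m ∣)))

{-# OPTIONS --safe #-}
-- Write a two-digit number as u b + y.  Multiplying the fixed point equation
-- c + u² + y² = u b + y by 4 and completing squares turns it into
-- (2u − b)² + (2y − 1)² = b² − 4c + 1.  The fixed points with y = 0 make up F⁽¹⁾, and
-- (u, y) ↦ (2u − b, 2y − 1) maps those with y ≥ 1 bijectively onto the lattice points
-- (X, Y) of this circle with X ≡ b (mod 2) and Y odd and positive.  As a square is
-- ≡ 0 or 1 (mod 4) according to parity, every lattice point of the circle has both
-- coordinates odd when b is odd, and coordinates of opposite parity when b is even;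
-- the symmetries Y ↦ −Y and (X, Y) ↦ (Y, X) then give the factors 1/2 and 1/4.
module Submission where

open import Data.Nat
open import Data.Nat.Properties
open import Data.Nat.DivMod
open import Data.Nat.ListAction using (sum)
open import Data.Nat.ListAction.Properties using (sum-++)
open import Data.Nat.Tactic.RingSolver using (solve-∀)
open import Data.Integer as ℤ using (ℤ; -[1+_]; ∣_∣)
import Data.Integer.Properties as ℤ
import Data.Integer.Tactic.RingSolver as ℤ-RingSolver
open import Data.List using ([]; _∷_; map; length; filter; applyUpTo; upTo; cartesianProduct; _++_)
open import Data.List.Properties using (map-++; map-∘; map-cong)
open import Data.Product using (_×_; _,_; proj₂; ∃-syntax)
open import Data.Sum using (_⊎_; inj₁; inj₂; [_,_]′)
open import Function.Base using (_∘_)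
open import Function.Bundles using (_⇔_; mk⇔; Equivalence)
open import Relation.Nullary using (Dec; yes; no; ¬_; contradiction; _×-dec_)
open import Relation.Unary using (Pred; Decidable)
open import Relation.Binary.PropositionalEquality
open ≡-Reasoning

open import Defs

𝟙 : ∀ {p} {P : Set p} → Dec P → ℕ
𝟙 (yes _) = 1
𝟙 (no _)  = 0

module _ {p} {P : Set p} where

  𝟙≡0⊎ : (P? : Dec P) → 𝟙 P? ≡ 0 ⊎ P
  𝟙≡0⊎ (yes p) = inj₂ p
  𝟙≡0⊎ (no _)  = inj₁ refl

  𝟙-yes : P → (P? : Dec P) → 𝟙 P? ≡ 1
  𝟙-yes p (yes _) = refl
  𝟙-yes p (no ¬p) = contradiction p ¬p

  𝟙-no : ¬ P → (P? : Dec P) → 𝟙 P? ≡ 0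
  𝟙-no ¬p (yes p) = contradiction p ¬p
  𝟙-no ¬p (no _)  = refl

𝟙-cong : ∀ {p q} {P : Set p} {Q : Set q} → P ⇔ Q → (P? : Dec P) (Q? : Dec Q) → 𝟙 P? ≡ 𝟙 Q?
𝟙-cong P⇔Q (yes p) Q? = sym (𝟙-yes (Equivalence.to P⇔Q p) Q?)
𝟙-cong P⇔Q (no ¬p) Q? = sym (𝟙-no (¬p ∘ Equivalence.from P⇔Q) Q?)

-- Finite sums over initial segments of ℕ

∑< : ℕ → (ℕ → ℕ) → ℕ
∑< zero    f = 0
∑< (suc n) f = f 0 + ∑< n (λ i → f (suc i))

infixr 10 ∑<
syntax ∑< n (λ i → e) = ∑[ i < n ] e

∑-cong : ∀ n {f g : ℕ → ℕ} → (∀ i → i < n → f i ≡ g i) → ∑< n f ≡ ∑< n g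
∑-cong zero    f≡g = refl
∑-cong (suc n) f≡g = cong₂ _+_ (f≡g 0 z<s) (∑-cong n (λ i i<n → f≡g (suc i) (s<s i<n)))

∑-zero : ∀ n {f : ℕ → ℕ} → (∀ i → i < n → f i ≡ 0) → ∑< n f ≡ 0
∑-zero n f≡0 = trans (∑-cong n f≡0) (zeros n)
  where
  zeros : ∀ n → ∑[ i < n ] 0 ≡ 0
  zeros zero    = refl
  zeros (suc n) = zeros n

∑-+ : ∀ m n (f : ℕ → ℕ) → ∑< (m + n) f ≡ ∑< m f + ∑[ i < n ] f (m + i)
∑-+ zero    n f = refl
∑-+ (suc m) n f = trans (cong (f 0 +_) (∑-+ m n (λ i → f (suc i)))) (sym (+-assoc (f 0) _ _))

∑-last : ∀ n (f : ℕ → ℕ) → ∑< (suc n) f ≡ ∑< n f + f n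
∑-last n f = begin
  ∑< (suc n) f               ≡⟨ cong (λ k → ∑< k f) (+-comm 1 n) ⟩
  ∑< (n + 1) f               ≡⟨ ∑-+ n 1 f ⟩
  ∑< n f + (f (n + 0) + 0)   ≡⟨ cong (∑< n f +_) (trans (+-identityʳ _) (cong f (+-identityʳ n))) ⟩
  ∑< n f + f n               ∎

∑-distrib-+ : ∀ n (f g : ℕ → ℕ) → ∑[ i < n ] (f i + g i) ≡ ∑< n f + ∑< n g
∑-distrib-+ zero    f g = refl
∑-distrib-+ (suc n) f g =
  trans (cong (f 0 + g 0 +_) (∑-distrib-+ n (λ i → f (suc i)) (λ i → g (suc i))))
        (+-+-comm (f 0) (g 0) _ _)
  where
  +-+-comm : ∀ a b c d → a + b + (c + d) ≡ a + c + (b + d)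
  +-+-comm = solve-∀

*-distribˡ-∑ : ∀ n k (f : ℕ → ℕ) → k * ∑< n f ≡ ∑[ i < n ] (k * f i)
*-distribˡ-∑ zero    k f = *-zeroʳ k
*-distribˡ-∑ (suc n) k f =
  trans (*-distribˡ-+ k (f 0) _) (cong (k * f 0 +_) (*-distribˡ-∑ n k (λ i → f (suc i))))

∑-comm : ∀ m n (f : ℕ → ℕ → ℕ) → ∑[ i < m ] ∑[ j < n ] f i j ≡ ∑[ j < n ] ∑[ i < m ] f i j
∑-comm zero    n f = sym (∑-zero n (λ _ _ → refl))
∑-comm (suc m) n f = begin
  ∑< n (f 0) + ∑[ i < m ] ∑[ j < n ] f (suc i) j  ≡⟨ cong (∑< n (f 0) +_) (∑-comm m n (λ i → f (suc i))) ⟩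
  ∑< n (f 0) + ∑[ j < n ] ∑[ i < m ] f (suc i) j  ≡⟨ ∑-distrib-+ n (f 0) _ ⟨
  ∑[ j < n ] (f 0 j + ∑[ i < m ] f (suc i) j)     ∎

∑-* : ∀ m n (f : ℕ → ℕ) → ∑< (m * n) f ≡ ∑[ x < m ] ∑[ y < n ] f (x * n + y)
∑-* zero    n f = refl
∑-* (suc m) n f = begin
  ∑< (n + m * n) f                                   ≡⟨ ∑-+ n (m * n) f ⟩
  ∑< n f + ∑[ i < m * n ] f (n + i)                  ≡⟨ cong (∑< n f +_) (∑-* m n (λ i → f (n + i))) ⟩
  ∑< n f + ∑[ x < m ] ∑[ y < n ] f (n + (x * n + y)) ≡⟨ cong (∑< n f +_) (∑-cong m (λ x _ → ∑-cong n (λ y _ →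
                                                          cong f (+-assoc n (x * n) y)))) ⟨
  ∑< n f + ∑[ x < m ] ∑[ y < n ] f (n + x * n + y)   ∎

∑-prefix : ∀ {k n} (f : ℕ → ℕ) → k ≤ n → (∀ i → k ≤ i → f i ≡ 0) → ∑< n f ≡ ∑< k f
∑-prefix {k} f k≤n f≡0 with d , refl ← m≤n⇒∃[o]m+o≡n k≤n = begin
  ∑< (k + d) f                   ≡⟨ ∑-+ k d f ⟩
  ∑< k f + ∑[ i < d ] f (k + i)  ≡⟨ cong (∑< k f +_) (∑-zero d (λ i _ → f≡0 (k + i) (m≤m+n k i))) ⟩
  ∑< k f + 0                     ≡⟨ +-identityʳ _ ⟩
  ∑< k f                         ∎

∑-restrict : ∀ {m n} (f : ℕ → ℕ) → (∀ i → f i ≡ 0 ⊎ (i < m × i < n)) → ∑< m f ≡ ∑< n f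
∑-restrict {m} {n} f supp =
  trans (∑-prefix f (m⊓n≤m m n) vanish) (sym (∑-prefix f (m⊓n≤n m n) vanish))
  where
  vanish : ∀ i → m ⊓ n ≤ i → f i ≡ 0
  vanish i m⊓n≤i with supp i
  ... | inj₁ fi≡0          = fi≡0
  ... | inj₂ (i<m , i<n) = contradiction m⊓n≤i (<⇒≱ (⊓-pres-m< i<m i<n))

∑∑-restrict : ∀ {m n} (f : ℕ → ℕ → ℕ) → (∀ i j → f i j ≡ 0 ⊎ ((i < m × i < n) × (j < m × j < n))) →
              ∑[ i < m ] ∑[ j < m ] f i j ≡ ∑[ i < n ] ∑[ j < n ] f i j
∑∑-restrict {m} {n} f supp =
  trans (∑-cong m (λ i _ → ∑-restrict (f i) (columnSupport i))) (∑-restrict (λ i → ∑[ j < n ] f i j) rowSupport)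
  where
  columnSupport : ∀ i j → f i j ≡ 0 ⊎ (j < m × j < n)
  columnSupport i j with supp i j
  ... | inj₁ fij≡0            = inj₁ fij≡0
  ... | inj₂ (_ , j-bounds) = inj₂ j-bounds
  rowSupport : ∀ i → ∑[ j < n ] f i j ≡ 0 ⊎ (i < m × i < n)
  rowSupport i with (i <? m) ×-dec (i <? n)
  ... | yes i-bounds = inj₂ i-bounds
  ... | no ¬i-bounds = inj₁ (∑-zero n vanish)
    where
    vanish : ∀ j → j < n → f i j ≡ 0
    vanish j _ with supp i j
    ... | inj₁ fij≡0            = fij≡0
    ... | inj₂ (i-bounds , _) = contradiction i-bounds ¬i-bounds


[m*n+o]%n≡o : ∀ m {n o} .{{_ : NonZero n}} → o < n → (m * n + o) % n ≡ o
[m*n+o]%n≡o m {n} {o} o<n =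
  trans (cong (_% n) (+-comm (m * n) o)) (trans ([m+kn]%n≡m%n o m n) (m<n⇒m%n≡m o<n))

[m*n+o]/n≡m : ∀ m {n o} .{{_ : NonZero n}} → o < n → (m * n + o) / n ≡ m
[m*n+o]/n≡m m {n} {o} o<n = begin
  (m * n + o) / n      ≡⟨ +-distrib-/ (m * n) o remainders<n ⟩
  m * n / n + o / n    ≡⟨ cong₂ _+_ (m*n/n≡m m n) (m<n⇒m/n≡0 o<n) ⟩
  m + 0                ≡⟨ +-identityʳ m ⟩
  m                    ∎
  where
  remainders<n : (m * n) % n + o % n < n
  remainders<n = subst (_< n) (sym (cong₂ _+_ (m*n%n≡0 m n) (m<n⇒m%n≡m o<n))) o<n

∣m-n∣*∣m-n∣+2mn≡m*m+n*n : ∀ m n → ∣ m - n ∣ * ∣ m - n ∣ + 2 * (m * n) ≡ m * m + n * n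
∣m-n∣*∣m-n∣+2mn≡m*m+n*n m n = [ ascending , descending ]′ (≤-total m n)
  where
  square : ∀ m d → d * d + 2 * (m * (m + d)) ≡ m * m + (m + d) * (m + d)
  square = solve-∀
  ascending : ∀ {m n} → m ≤ n → ∣ m - n ∣ * ∣ m - n ∣ + 2 * (m * n) ≡ m * m + n * n
  ascending {m} m≤n with d , refl ← m≤n⇒∃[o]m+o≡n m≤n rewrite ∣m-m+n∣≡n m d = square m d
  descending : n ≤ m → ∣ m - n ∣ * ∣ m - n ∣ + 2 * (m * n) ≡ m * m + n * n
  descending n≤m = begin
    ∣ m - n ∣ * ∣ m - n ∣ + 2 * (m * n)  ≡⟨ cong₂ (λ d k → d * d + 2 * k) (∣-∣-comm m n) (*-comm m n) ⟩
    ∣ n - m ∣ * ∣ n - m ∣ + 2 * (n * m)  ≡⟨ ascending n≤m ⟩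
    n * n + m * m                        ≡⟨ +-comm (n * n) (m * m) ⟩
    m * m + n * n                        ∎

+-*-cancel-⇔ : ∀ k .{{_ : NonZero k}} {p q r s} → p + k * q ≡ r + k * s → q ≡ s ⇔ p ≡ r
+-*-cancel-⇔ k {p} {q} {r} {s} eq = mk⇔
  (λ q≡s → +-cancelʳ-≡ (k * s) p r (subst (λ x → p + k * x ≡ r + k * s) q≡s eq))
  (λ p≡r → *-cancelˡ-≡ q s k (+-cancelˡ-≡ r _ _ (subst (λ x → x + k * q ≡ r + k * s) p≡r eq)))

[1+n]%2≢n%2 : ∀ n → suc n % 2 ≢ n % 2
[1+n]%2≢n%2 zero          ()
[1+n]%2≢n%2 (suc zero)    ()
[1+n]%2≢n%2 (suc (suc n)) = [1+n]%2≢n%2 n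

[n%2]*[n%2]≡n%2 : ∀ n → n % 2 * (n % 2) ≡ n % 2
[n%2]*[n%2]≡n%2 zero          = refl
[n%2]*[n%2]≡n%2 (suc zero)    = refl
[n%2]*[n%2]≡n%2 (suc (suc n)) = [n%2]*[n%2]≡n%2 n

n*n≡n%2+4k : ∀ n → ∃[ k ] n * n ≡ n % 2 + k * 4
n*n≡n%2+4k n = n / 2 * (n / 2 + n % 2) , (begin
  n * n                                    ≡⟨ cong₂ _*_ n≡r+2h n≡r+2h ⟩
  (r + h * 2) * (r + h * 2)                ≡⟨ expand r h ⟩
  r * r + h * (h + r) * 4                  ≡⟨ cong (_+ h * (h + r) * 4) ([n%2]*[n%2]≡n%2 n) ⟩
  r + h * (h + r) * 4                      ∎)
  where
  r = n % 2
  h = n / 2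
  n≡r+2h : n ≡ r + h * 2
  n≡r+2h = m≡m%n+[m/n]*n n 2
  expand : ∀ r h → (r + h * 2) * (r + h * 2) ≡ r * r + h * (h + r) * 4
  expand = solve-∀

m+kn≡o+ln⇒m≡o : ∀ {m n o} k l .{{_ : NonZero n}} → m < n → o < n → m + k * n ≡ o + l * n → m ≡ o
m+kn≡o+ln⇒m≡o {m} {n} {o} k l m<n o<n eq = begin
  m              ≡⟨ m<n⇒m%n≡m m<n ⟨
  m % n          ≡⟨ [m+kn]%n≡m%n m k n ⟨
  (m + k * n) % n ≡⟨ cong (_% n) eq ⟩
  (o + l * n) % n ≡⟨ [m+kn]%n≡m%n o l n ⟩
  o % n          ≡⟨ m<n⇒m%n≡m o<n ⟩
  o              ∎

x+y≡2⇒x≡1×y≡1 : ∀ {x y} → x < 2 → y < 2 → x + y ≡ 2 → x ≡ 1 × y ≡ 1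
x+y≡2⇒x≡1×y≡1 z<s       z<s       ()
x+y≡2⇒x≡1×y≡1 z<s       (s<s z<s) ()
x+y≡2⇒x≡1×y≡1 (s<s z<s) z<s       ()
x+y≡2⇒x≡1×y≡1 (s<s z<s) (s<s z<s) refl = refl , refl

x+y≡1⇒[x,y]≡[0,1]⊎[1,0] : ∀ {x y} → x < 2 → y < 2 → x + y ≡ 1 → (x ≡ 0 × y ≡ 1) ⊎ (x ≡ 1 × y ≡ 0)
x+y≡1⇒[x,y]≡[0,1]⊎[1,0] z<s       z<s       ()
x+y≡1⇒[x,y]≡[0,1]⊎[1,0] z<s       (s<s z<s) refl = inj₁ (refl , refl)
x+y≡1⇒[x,y]≡[0,1]⊎[1,0] (s<s z<s) z<s       refl = inj₂ (refl , refl)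
x+y≡1⇒[x,y]≡[0,1]⊎[1,0] (s<s z<s) (s<s z<s) ()


∑-odd : ∀ n (f : ℕ → ℕ) → ∑[ s < n ] f (suc (s + s)) ≡ ∑[ j < n + n ] (𝟙 (j % 2 ≟ 1) * f j)
∑-odd zero    f = refl
∑-odd (suc n) f = begin
  f 1 + ∑[ s < n ] f (suc (suc s + suc s))
    ≡⟨ cong (f 1 +_) (∑-cong n (λ s _ → cong (λ k → f (suc k)) (+-suc (suc s) s))) ⟩
  f 1 + ∑[ s < n ] f (suc (suc (suc (s + s))))
    ≡⟨ cong₂ _+_ (sym (*-identityˡ (f 1))) (∑-odd n (λ j → f (suc (suc j)))) ⟩
  𝟙 (1 ≟ 1) * f 1 + ∑[ j < n + n ] (𝟙 (j % 2 ≟ 1) * f (suc (suc j)))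
    ≡⟨ cong (λ k → ∑[ j < k ] (𝟙 (suc j % 2 ≟ 1) * f (suc j))) (+-suc n n) ⟨
  ∑[ j < n + suc n ] (𝟙 (suc j % 2 ≟ 1) * f (suc j))
    ∎

abs⁻¹-size : ℕ → ℕ
abs⁻¹-size zero    = 1
abs⁻¹-size (suc _) = 2

∑-∣u+u-n∣ : ∀ n (f : ℕ → ℕ) →
            ∑[ u < suc n ] f ∣ u + u - n ∣ ≡ ∑[ i < 2 + n ] (𝟙 (i % 2 ≟ n % 2) * (abs⁻¹-size i * f i))
∑-∣u+u-n∣ zero          f = base (f 0)
  where
  base : ∀ x → x + 0 ≡ 1 * (1 * x) + 0
  base = solve-∀
∑-∣u+u-n∣ (suc zero)    f = base (f 1)
  where
  base : ∀ x → x + (x + 0) ≡ 1 * (2 * x) + 0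
  base = solve-∀
∑-∣u+u-n∣ (suc (suc n)) f = begin
  f (2 + n) + ∑[ u < 2 + n ] f ∣ suc u + suc u - 2 + n ∣
    ≡⟨ cong (f (2 + n) +_) (∑-cong (2 + n) (λ u _ → cong (λ k → f ∣ k - 1 + n ∣) (+-suc u u))) ⟩
  f (2 + n) + ∑[ u < 2 + n ] f ∣ u + u - n ∣
    ≡⟨ cong (f (2 + n) +_) (∑-last (suc n) (λ u → f ∣ u + u - n ∣)) ⟩
  f (2 + n) + (∑[ u < suc n ] f ∣ u + u - n ∣ + f ∣ suc n + suc n - n ∣)
    ≡⟨ cong₂ (λ s x → f (2 + n) + (s + f x)) (∑-∣u+u-n∣ n f) ∣[1+n]+[1+n]-n∣≡2+n ⟩
  f (2 + n) + (R + f (2 + n))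
    ≡⟨ rearrange (f (2 + n)) (f (3 + n)) R ⟩
  R + 1 * (2 * f (2 + n)) + 0 * (2 * f (3 + n))
    ≡⟨ cong₂ (λ a b → R + a * (2 * f (2 + n)) + b * (2 * f (3 + n)))
             (𝟙-yes refl (n % 2 ≟ n % 2)) (𝟙-no ([1+n]%2≢n%2 n) (suc n % 2 ≟ n % 2)) ⟨
  R + F (2 + n) + F (3 + n)
    ≡⟨ cong (_+ F (3 + n)) (∑-last (2 + n) F) ⟨
  ∑< (3 + n) F + F (3 + n)
    ≡⟨ ∑-last (3 + n) F ⟨
  ∑< (4 + n) F
    ∎
  where
  F : ℕ → ℕ
  F i = 𝟙 (i % 2 ≟ n % 2) * (abs⁻¹-size i * f i)
  R : ℕ
  R = ∑< (2 + n) F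
  ∣[1+n]+[1+n]-n∣≡2+n : ∣ suc n + suc n - n ∣ ≡ 2 + n
  ∣[1+n]+[1+n]-n∣≡2+n = begin
    ∣ suc n + suc n - n ∣  ≡⟨ ∣-∣-comm (suc n + suc n) n ⟩
    ∣ n - suc n + suc n ∣  ≡⟨ cong (λ k → ∣ n - k ∣) (+-suc (suc n) n) ⟩
    ∣ n - 2 + n + n ∣      ≡⟨ cong (λ k → ∣ n - k ∣) (+-comm (2 + n) n) ⟩
    ∣ n - n + (2 + n) ∣    ≡⟨ ∣m-m+n∣≡n n (2 + n) ⟩
    2 + n                  ∎
  rearrange : ∀ x y r → x + (r + x) ≡ r + 1 * (2 * x) + 0 * (2 * y)
  rearrange = solve-∀

abs⁻¹-size-odd : ∀ j x → 2 * (𝟙 (j % 2 ≟ 1) * x) ≡ 𝟙 (j % 2 ≟ 1) * (abs⁻¹-size j * x)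
abs⁻¹-size-odd zero    x = refl
abs⁻¹-size-odd (suc j) x = swap (𝟙 (suc j % 2 ≟ 1)) x
  where
  swap : ∀ a x → 2 * (a * x) ≡ a * (2 * x)
  swap = solve-∀


length-filter≡sum : ∀ {a p} {A : Set a} {P : Pred A p} (P? : Decidable P) xs →
                    length (filter P? xs) ≡ sum (map (λ x → 𝟙 (P? x)) xs)
length-filter≡sum P? []       = refl
length-filter≡sum P? (x ∷ xs) with P? x
... | yes _ = cong suc (length-filter≡sum P? xs)
... | no  _ = length-filter≡sum P? xs

sum-map-applyUpTo : ∀ {a} {A : Set a} (f : A → ℕ) (g : ℕ → A) n →
                    sum (map f (applyUpTo g n)) ≡ ∑[ i < n ] f (g i)
sum-map-applyUpTo f g zero    = refl
sum-map-applyUpTo f g (suc n) = cong (f (g 0) +_) (sum-map-applyUpTo f (λ i → g (suc i)) n)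

sum-map-cartesianProduct : ∀ {a} {A B : Set a} (f : A × B → ℕ) xs ys →
  sum (map f (cartesianProduct xs ys)) ≡ sum (map (λ x → sum (map (λ y → f (x , y)) ys)) xs)
sum-map-cartesianProduct f []       ys = refl
sum-map-cartesianProduct f (x ∷ xs) ys = begin
  sum (map f (map (x ,_) ys ++ cartesianProduct xs ys))
    ≡⟨ cong sum (map-++ f (map (x ,_) ys) _) ⟩
  sum (map f (map (x ,_) ys) ++ map f (cartesianProduct xs ys))
    ≡⟨ sum-++ (map f (map (x ,_) ys)) _ ⟩
  sum (map f (map (x ,_) ys)) + sum (map f (cartesianProduct xs ys))
    ≡⟨ cong₂ _+_ (cong sum (map-∘ ys)) (sym (sum-map-cartesianProduct f xs ys)) ⟨
  sum (map (λ y → f (x , y)) ys) + sum (map (λ x → sum (map (λ y → f (x , y)) ys)) xs)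
    ∎

sum-map-intRange : ∀ K (f : ℕ → ℕ) →
                   sum (map (λ X → f ∣ X ∣) (intRange K)) ≡ ∑[ i < suc K ] (abs⁻¹-size i * f i)
sum-map-intRange K f = begin
  sum (map F (map ℤ.+_ (upTo (suc K)) ++ map -[1+_] (upTo K)))
    ≡⟨ cong sum (map-++ F (map ℤ.+_ (upTo (suc K))) _) ⟩
  sum (map F (map ℤ.+_ (upTo (suc K))) ++ map F (map -[1+_] (upTo K)))
    ≡⟨ sum-++ (map F (map ℤ.+_ (upTo (suc K)))) _ ⟩
  sum (map F (map ℤ.+_ (upTo (suc K)))) + sum (map F (map -[1+_] (upTo K)))
    ≡⟨ cong₂ _+_ (cong sum (map-∘ (upTo (suc K)))) (cong sum (map-∘ (upTo K))) ⟨
  sum (map f (upTo (suc K))) + sum (map (λ i → f (suc i)) (upTo K))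
    ≡⟨ cong₂ _+_ (sum-map-applyUpTo f (λ i → i) (suc K)) (sum-map-applyUpTo (λ i → f (suc i)) (λ i → i) K) ⟩
  f 0 + rest + rest
    ≡⟨ rearrange (f 0) rest ⟩
  1 * f 0 + 2 * rest
    ≡⟨ cong (1 * f 0 +_) (*-distribˡ-∑ K 2 (λ i → f (suc i))) ⟩
  1 * f 0 + ∑[ i < K ] (2 * f (suc i))
    ∎
  where
  F : ℤ → ℕ
  F X = f ∣ X ∣
  rest : ℕ
  rest = ∑[ i < K ] f (suc i)
  rearrange : ∀ x s → x + s + s ≡ 1 * x + 2 * s
  rearrange = solve-∀

i*i≡+∣i∣*∣i∣ : ∀ i → i ℤ.* i ≡ ℤ.+ (∣ i ∣ * ∣ i ∣)
i*i≡+∣i∣*∣i∣ (ℤ.+ n)  = ℤ.+◃n≡+n _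
i*i≡+∣i∣*∣i∣ -[1+ n ] = ℤ.+◃n≡+n _

r2≡∑ : ∀ m → r2 m ≡ ∑[ i < suc ∣ m ∣ ] (abs⁻¹-size i *
                      ∑[ j < suc ∣ m ∣ ] (abs⁻¹-size j * 𝟙 (ℤ.+ (i * i + j * j) ℤ.≟ m)))
r2≡∑ m = begin
  r2 m
    ≡⟨ length-filter≡sum _ (cartesianProduct L L) ⟩
  sum (map _ (cartesianProduct L L))
    ≡⟨ sum-map-cartesianProduct _ L L ⟩
  sum (map (λ X → sum (map (λ Y → 𝟙 ((X ℤ.* X ℤ.+ Y ℤ.* Y) ℤ.≟ m)) L)) L)
    ≡⟨ cong sum (map-cong (λ X → cong sum (map-cong (λ Y → cong (λ k → 𝟙 (k ℤ.≟ m)) (squares X Y)) L)) L) ⟩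
  sum (map (λ X → sum (map (λ Y → 𝟙 (ℤ.+ (∣ X ∣ * ∣ X ∣ + ∣ Y ∣ * ∣ Y ∣) ℤ.≟ m)) L)) L)
    ≡⟨ cong sum (map-cong (λ X → sum-map-intRange K (λ j → 𝟙 (ℤ.+ (∣ X ∣ * ∣ X ∣ + j * j) ℤ.≟ m))) L) ⟩
  sum (map (λ X → ∑[ j < suc K ] (abs⁻¹-size j * 𝟙 (ℤ.+ (∣ X ∣ * ∣ X ∣ + j * j) ℤ.≟ m))) L)
    ≡⟨ sum-map-intRange K (λ i → ∑[ j < suc K ] (abs⁻¹-size j * 𝟙 (ℤ.+ (i * i + j * j) ℤ.≟ m))) ⟩
  ∑[ i < suc K ] (abs⁻¹-size i * ∑[ j < suc K ] (abs⁻¹-size j * 𝟙 (ℤ.+ (i * i + j * j) ℤ.≟ m)))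
    ∎
  where
  K = ∣ m ∣
  L = intRange K
  squares : ∀ X Y → X ℤ.* X ℤ.+ Y ℤ.* Y ≡ ℤ.+ (∣ X ∣ * ∣ X ∣ + ∣ Y ∣ * ∣ Y ∣)
  squares X Y = trans (cong₂ ℤ._+_ (i*i≡+∣i∣*∣i∣ X) (i*i≡+∣i∣*∣i∣ Y)) (sym (ℤ.pos-+ (∣ X ∣ * ∣ X ∣) (∣ Y ∣ * ∣ Y ∣)))


-- Two-digit fixed points

digitsAux-oneDigit : ∀ f {b d} → suc d < suc b → digitsAux (suc f) (suc b) (suc d) ≡ suc d ∷ []
digitsAux-oneDigit f d<b rewrite m<n⇒m%n≡m d<b | m<n⇒m/n≡0 d<b with f
... | zero  = refl
... | suc _ = refl

digits-twoDigit : ∀ {b u y} → 0 < u → u < b → y < b → digits b (u * b + y) ≡ y ∷ u ∷ []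
digits-twoDigit {suc (suc b)} {suc u} {y} _ u<b y<b =
  cong₂ _∷_ ([m*n+o]%n≡o (suc u) y<b)
            (trans (cong (digitsAux _ (2 + b)) ([m*n+o]/n≡m (suc u) y<b)) (digitsAux-oneDigit _ u<b))
digits-twoDigit {suc zero} {suc _} _ (s<s ()) _

S-twoDigit : ∀ c {b u y} → 0 < u → u < b → y < b → S c b (u * b + y) ≡ c + (y * y + u * u)
S-twoDigit c {u = u} {y} 0<u u<b y<b = begin
  c + sum (map (λ d → d * d) (digits _ (u * _ + y)))
    ≡⟨ cong (λ ds → c + sum (map (λ d → d * d) ds)) (digits-twoDigit 0<u u<b y<b) ⟩
  c + (y * y + (u * u + 0))
    ≡⟨ cong (λ k → c + (y * y + k)) (+-identityʳ (u * u)) ⟩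
  c + (y * y + u * u)
    ∎

isFixedDigits : ℕ → ℕ → ℕ → ℕ → ℕ
isFixedDigits c b u y = 𝟙 (c + (y * y + u * u) ≟ u * b + y)

isFixed-twoDigit : ∀ c {b u y} → 0 < u → u < b → y < b →
                   𝟙 (S c b (u * b + y) ≟ u * b + y) ≡ isFixedDigits c b u y
isFixed-twoDigit c {b} {u} {y} 0<u u<b y<b = cong (λ s → 𝟙 (s ≟ u * b + y)) (S-twoDigit c 0<u u<b y<b)

twoDigitFixedCount≡∑ : ∀ c n →
  twoDigitFixedCount c (2 + n) ≡ ∑[ u < suc n ] ∑[ y < 2 + n ] isFixedDigits c (2 + n) (suc u) y
twoDigitFixedCount≡∑ c n = begin
  twoDigitFixedCount c b
    ≡⟨ length-filter≡sum _ (applyUpTo (b +_) (b * b ∸ b)) ⟩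
  sum (map (λ a → 𝟙 (S c b a ≟ a)) (applyUpTo (b +_) (b * b ∸ b)))
    ≡⟨ sum-map-applyUpTo (λ a → 𝟙 (S c b a ≟ a)) (b +_) (b * b ∸ b) ⟩
  ∑[ i < b * b ∸ b ] 𝟙 (S c b (b + i) ≟ b + i)
    ≡⟨ cong (λ k → ∑[ i < k ] 𝟙 (S c b (b + i) ≟ b + i)) (m+n∸m≡n b (suc n * b)) ⟩
  ∑[ i < suc n * b ] 𝟙 (S c b (b + i) ≟ b + i)
    ≡⟨ ∑-* (suc n) b (λ i → 𝟙 (S c b (b + i) ≟ b + i)) ⟩
  ∑[ u < suc n ] ∑[ y < b ] 𝟙 (S c b (b + (u * b + y)) ≟ b + (u * b + y))
    ≡⟨ ∑-cong (suc n) (λ u u<1+n → ∑-cong b (λ y y<b →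
         trans (cong (λ a → 𝟙 (S c b a ≟ a)) (sym (+-assoc b (u * b) y)))
               (isFixed-twoDigit c z<s (s<s u<1+n) y<b))) ⟩
  ∑[ u < suc n ] ∑[ y < b ] isFixedDigits c b (suc u) y
    ∎
  where
  b = 2 + n

F1count≡∑ : ∀ c n → F1count c (2 + n) ≡ ∑[ u < suc n ] isFixedDigits c (2 + n) (suc u) 0
F1count≡∑ c n = begin
  F1count c b
    ≡⟨ length-filter≡sum _ (applyUpTo suc (suc n)) ⟩
  sum (map (λ u → 𝟙 (S c b (u * b) ≟ u * b)) (applyUpTo suc (suc n)))
    ≡⟨ sum-map-applyUpTo (λ u → 𝟙 (S c b (u * b) ≟ u * b)) suc (suc n) ⟩
  ∑[ u < suc n ] 𝟙 (S c b (suc u * b) ≟ suc u * b)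
    ≡⟨ ∑-cong (suc n) (λ u u<1+n →
         trans (cong (λ a → 𝟙 (S c b a ≟ a)) (sym (+-identityʳ (suc u * b))))
               (isFixed-twoDigit c z<s (s<s u<1+n) z<s)) ⟩
  ∑[ u < suc n ] isFixedDigits c b (suc u) 0
    ∎
  where
  b = 2 + n

twoDigitFixedCount≡F1count+∑ : ∀ c n → twoDigitFixedCount c (2 + n) ≡
  F1count c (2 + n) + ∑[ u < suc n ] ∑[ s < suc n ] isFixedDigits c (2 + n) (suc u) (suc s)
twoDigitFixedCount≡F1count+∑ c n = begin
  twoDigitFixedCount c (2 + n)        ≡⟨ twoDigitFixedCount≡∑ c n ⟩
  ∑[ u < suc n ] (fixed u 0 + row u)  ≡⟨ ∑-distrib-+ (suc n) (λ u → fixed u 0) row ⟩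
  ∑[ u < suc n ] fixed u 0 + D        ≡⟨ cong (_+ D) (F1count≡∑ c n) ⟨
  F1count c (2 + n) + D               ∎
  where
  fixed : ℕ → ℕ → ℕ
  fixed u y = isFixedDigits c (2 + n) (suc u) y
  row : ℕ → ℕ
  row u = ∑[ s < suc n ] fixed u (suc s)
  D = ∑< (suc n) row


-- Lattice points on the circle X² + Y² = b² − 4c + 1

-- i² + j² = b² − 4c + 1, with 4c moved across to avoid truncated subtraction
onCircle : ℕ → ℕ → ℕ → ℕ → ℕ
onCircle c b i j = 𝟙 (i * i + j * j + 4 * c ≟ b * b + 1)

isFixedDigits≡onCircle : ∀ c b u s → isFixedDigits c b u (suc s) ≡ onCircle c b ∣ u + u - b ∣ (suc (s + s))
isFixedDigits≡onCircle c b u s = 𝟙-cong (mk⇔ (to ∘ sym) (sym ∘ from)) _ _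
  where
  d = ∣ u + u - b ∣
  y = suc s
  j = suc (s + s)
  regroup : ∀ d u b s c → d * d + suc (s + s) * suc (s + s) + 4 * c + 4 * (u * b + suc s)
                        ≡ d * d + 2 * ((u + u) * b) + (suc (s + s) * suc (s + s) + 4 * c + 4 * suc s)
  regroup = solve-∀
  expand : ∀ u b s c → (u + u) * (u + u) + b * b + (suc (s + s) * suc (s + s) + 4 * c + 4 * suc s)
                     ≡ b * b + 1 + 4 * (c + (suc s * suc s + u * u))
  expand = solve-∀
  -- (2u − b)² + (2y − 1)² + 4c − (b² + 1) = 4 (c + y² + u² − (u b + y)), both sides moved so that no subtraction occurs
  identity : d * d + j * j + 4 * c + 4 * (u * b + y) ≡ b * b + 1 + 4 * (c + (y * y + u * u))
  identity = begin
    d * d + j * j + 4 * c + 4 * (u * b + y)              ≡⟨ regroup d u b s c ⟩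
    d * d + 2 * ((u + u) * b) + (j * j + 4 * c + 4 * y)  ≡⟨ cong (_+ (j * j + 4 * c + 4 * y)) (∣m-n∣*∣m-n∣+2mn≡m*m+n*n (u + u) b) ⟩
    (u + u) * (u + u) + b * b + (j * j + 4 * c + 4 * y)  ≡⟨ expand u b s c ⟩
    b * b + 1 + 4 * (c + (y * y + u * u))                ∎
  open Equivalence (+-*-cancel-⇔ 4 {d * d + j * j + 4 * c} {u * b + y} {b * b + 1} {c + (y * y + u * u)} identity)

onCircle-swap : ∀ c b i j → i * i + j * j + 4 * c ≡ b * b + 1 → j * j + i * i + 4 * c ≡ b * b + 1
onCircle-swap c b i j = trans (cong (_+ 4 * c) (+-comm (j * j) (i * i)))

radius² : ℕ → ℕ → ℤ
radius² c b = ℤ.+ (b * b) ℤ.- ℤ.+ (4 * c) ℤ.+ ℤ.+ 1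

+n≡radius²⇔ : ∀ c b n → ℤ.+ n ≡ radius² c b ⇔ n + 4 * c ≡ b * b + 1
+n≡radius²⇔ c b n = mk⇔
  (λ n≡r → ℤ.+-injective (begin
    ℤ.+ n ℤ.+ ℤ.+ (4 * c)          ≡⟨ cong (ℤ._+ ℤ.+ (4 * c)) n≡r ⟩
    radius² c b ℤ.+ ℤ.+ (4 * c)    ≡⟨ add-back (ℤ.+ (b * b)) (ℤ.+ (4 * c)) ⟩
    ℤ.+ (b * b) ℤ.+ ℤ.+ 1          ∎))
  (λ n+4c≡b²+1 → begin
    ℤ.+ n                              ≡⟨ subtract-back (ℤ.+ n) (ℤ.+ (4 * c)) ⟩
    ℤ.+ n ℤ.+ ℤ.+ (4 * c) ℤ.- ℤ.+ (4 * c)  ≡⟨ cong (ℤ._- ℤ.+ (4 * c)) (cong ℤ.+_ n+4c≡b²+1) ⟩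
    ℤ.+ (b * b) ℤ.+ ℤ.+ 1 ℤ.- ℤ.+ (4 * c)  ≡⟨ reorder (ℤ.+ (b * b)) (ℤ.+ (4 * c)) ⟩
    radius² c b                        ∎)
  where
  add-back : ∀ x y → x ℤ.- y ℤ.+ ℤ.+ 1 ℤ.+ y ≡ x ℤ.+ ℤ.+ 1
  add-back = ℤ-RingSolver.solve-∀
  subtract-back : ∀ x y → x ≡ x ℤ.+ y ℤ.- y
  subtract-back = ℤ-RingSolver.solve-∀
  reorder : ∀ x y → x ℤ.+ ℤ.+ 1 ℤ.- y ≡ x ℤ.- y ℤ.+ ℤ.+ 1
  reorder = ℤ-RingSolver.solve-∀

onCircle-bounds : ∀ {c b i j} → 1 ≤ c → i * i + j * j + 4 * c ≡ b * b + 1 → i < suc ∣ radius² c b ∣ × i < b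
onCircle-bounds {c} {b} {i} {j} 1≤c eq = s≤s i≤r , i<b
  where
  n≤n*n : ∀ n → n ≤ n * n
  n≤n*n zero    = z≤n
  n≤n*n (suc n) = m≤m*n (suc n) (suc n)
  i≤r : i ≤ ∣ radius² c b ∣
  i≤r = ≤-trans (n≤n*n i) (≤-trans (m≤m+n (i * i) (j * j))
          (≤-reflexive (cong ∣_∣ (Equivalence.from (+n≡radius²⇔ c b (i * i + j * j)) eq))))
  i<b : i < b
  i<b = ≰⇒> λ b≤i → <⇒≱ (+-monoʳ-< (b * b) (s≤s (s≤s z≤n)))
    (≤-trans (+-mono-≤ (*-mono-≤ b≤i b≤i) (*-monoʳ-≤ 4 1≤c))
    (≤-trans (+-monoˡ-≤ (4 * c) (m≤m+n (i * i) (j * j))) (≤-reflexive eq)))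

onCircle-parity : ∀ {c b i j} → i * i + j * j + 4 * c ≡ b * b + 1 → i % 2 + j % 2 ≡ b % 2 + 1
onCircle-parity {c} {b} {i} {j} eq with n*n≡n%2+4k i | n*n≡n%2+4k j | n*n≡n%2+4k b
... | kᵢ , i*i≡ | kⱼ , j*j≡ | k , b*b≡ =
  m+kn≡o+ln⇒m≡o (kᵢ + kⱼ + c) k (+-mono-< (m%n<n i 2) (m%n<n j 2)) (+-mono-< (m%n<n b 2) (s≤s (s≤s z≤n))) (begin
    i % 2 + j % 2 + (kᵢ + kⱼ + c) * 4        ≡⟨ regroup (i % 2) (j % 2) kᵢ kⱼ c ⟩
    (i % 2 + kᵢ * 4) + (j % 2 + kⱼ * 4) + 4 * c  ≡⟨ cong₂ (λ x y → x + y + 4 * c) i*i≡ j*j≡ ⟨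
    i * i + j * j + 4 * c                    ≡⟨ eq ⟩
    b * b + 1                                ≡⟨ cong (_+ 1) b*b≡ ⟩
    b % 2 + k * 4 + 1                        ≡⟨ +-comm-1 (b % 2) (k * 4) ⟩
    b % 2 + 1 + k * 4                        ∎)
  where
  regroup : ∀ x y kx ky c → x + y + (kx + ky + c) * 4 ≡ (x + kx * 4) + (y + ky * 4) + 4 * c
  regroup = solve-∀
  +-comm-1 : ∀ x y → x + y + 1 ≡ x + 1 + y
  +-comm-1 = solve-∀

-- the number of lattice points (X, Y) on the circle with ∣ X ∣ ≡ i and ∣ Y ∣ ≡ j
circlePoints : ℕ → ℕ → ℕ → ℕ → ℕ
circlePoints c b i j = abs⁻¹-size i * (abs⁻¹-size j * onCircle c b i j)

circlePoints≡0⊎ : ∀ c b i j → circlePoints c b i j ≡ 0 ⊎ i * i + j * j + 4 * c ≡ b * b + 1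
circlePoints≡0⊎ c b i j with 𝟙≡0⊎ (i * i + j * j + 4 * c ≟ b * b + 1)
... | inj₂ eq          = inj₂ eq
... | inj₁ onCircle≡0 = inj₁ (begin
  abs⁻¹-size i * (abs⁻¹-size j * onCircle c b i j)  ≡⟨ cong (λ x → abs⁻¹-size i * (abs⁻¹-size j * x)) onCircle≡0 ⟩
  abs⁻¹-size i * (abs⁻¹-size j * 0)                 ≡⟨ cong (abs⁻¹-size i *_) (*-zeroʳ (abs⁻¹-size j)) ⟩
  abs⁻¹-size i * 0                                  ≡⟨ *-zeroʳ (abs⁻¹-size i) ⟩
  0                                                 ∎)

circlePoints-support : ∀ {c} b → 1 ≤ c → ∀ i j → circlePoints c b i j ≡ 0 ⊎
  ((i < suc ∣ radius² c b ∣ × i < b) × (j < suc ∣ radius² c b ∣ × j < b))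
circlePoints-support {c} b 1≤c i j with circlePoints≡0⊎ c b i j
... | inj₁ points≡0 = inj₁ points≡0
... | inj₂ eq       = inj₂ (onCircle-bounds {j = j} 1≤c eq , onCircle-bounds {j = i} 1≤c (onCircle-swap c b i j eq))

circlePoints-sym : ∀ c b i j → circlePoints c b i j ≡ circlePoints c b j i
circlePoints-sym c b i j = begin
  abs⁻¹-size i * (abs⁻¹-size j * onCircle c b i j)  ≡⟨ cong (λ x → abs⁻¹-size i * (abs⁻¹-size j * x)) onCircle-sym ⟩
  abs⁻¹-size i * (abs⁻¹-size j * onCircle c b j i)  ≡⟨ swap (abs⁻¹-size i) (abs⁻¹-size j) (onCircle c b j i) ⟩
  abs⁻¹-size j * (abs⁻¹-size i * onCircle c b j i)  ∎
  where
  swap : ∀ x y z → x * (y * z) ≡ y * (x * z)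
  swap = solve-∀
  onCircle-sym : onCircle c b i j ≡ onCircle c b j i
  onCircle-sym = 𝟙-cong (mk⇔ (onCircle-swap c b i j) (onCircle-swap c b j i)) _ _

r2≡∑circlePoints : ∀ c b → 1 ≤ c → r2 (radius² c b) ≡ ∑[ i < b ] ∑[ j < b ] circlePoints c b i j
r2≡∑circlePoints c b 1≤c = begin
  r2 (radius² c b)
    ≡⟨ r2≡∑ (radius² c b) ⟩
  ∑[ i < suc K ] (abs⁻¹-size i * ∑[ j < suc K ] (abs⁻¹-size j * 𝟙 (ℤ.+ (i * i + j * j) ℤ.≟ radius² c b)))
    ≡⟨ ∑-cong (suc K) (λ i _ → trans (*-distribˡ-∑ (suc K) (abs⁻¹-size i) (λ j → abs⁻¹-size j * 𝟙 (ℤ.+ (i * i + j * j) ℤ.≟ radius² c b))) (∑-cong (suc K) (λ j _ →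
         cong (λ x → abs⁻¹-size i * (abs⁻¹-size j * x)) (onCircle-ℤ i j)))) ⟩
  ∑[ i < suc K ] ∑[ j < suc K ] circlePoints c b i j
    ≡⟨ ∑∑-restrict (circlePoints c b) (circlePoints-support b 1≤c) ⟩
  ∑[ i < b ] ∑[ j < b ] circlePoints c b i j
    ∎
  where
  K = ∣ radius² c b ∣
  onCircle-ℤ : ∀ i j → 𝟙 (ℤ.+ (i * i + j * j) ℤ.≟ radius² c b) ≡ onCircle c b i j
  onCircle-ℤ i j = 𝟙-cong (+n≡radius²⇔ c b (i * i + j * j)) _ _

circlePointsWithParities : ℕ → ℕ → ℕ → ℕ → ℕ
circlePointsWithParities c b p q = ∑[ i < b ] ∑[ j < b ] (𝟙 (i % 2 ≟ p) * (𝟙 (j % 2 ≟ q) * circlePoints c b i j))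

circlePointsWithParities-comm : ∀ c b p q → circlePointsWithParities c b p q ≡ circlePointsWithParities c b q p
circlePointsWithParities-comm c b p q = trans (∑-comm b b _) (∑-cong b (λ j _ → ∑-cong b (λ i _ → begin
  𝟙 (i % 2 ≟ p) * (𝟙 (j % 2 ≟ q) * circlePoints c b i j)  ≡⟨ cong (λ x → 𝟙 (i % 2 ≟ p) * (𝟙 (j % 2 ≟ q) * x)) (circlePoints-sym c b i j) ⟩
  𝟙 (i % 2 ≟ p) * (𝟙 (j % 2 ≟ q) * circlePoints c b j i)  ≡⟨ swap (𝟙 (i % 2 ≟ p)) (𝟙 (j % 2 ≟ q)) (circlePoints c b j i) ⟩
  𝟙 (j % 2 ≟ q) * (𝟙 (i % 2 ≟ p) * circlePoints c b j i)  ∎)))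
  where
  swap : ∀ x y z → x * (y * z) ≡ y * (x * z)
  swap = solve-∀

r2-odd : ∀ c b → 1 ≤ c → b % 2 ≡ 1 → r2 (radius² c b) ≡ circlePointsWithParities c b 1 1
r2-odd c b 1≤c b-odd = trans (r2≡∑circlePoints c b 1≤c) (∑-cong b (λ i _ → ∑-cong b (λ j _ → odd-only i j)))
  where
  odd-only : ∀ i j → circlePoints c b i j ≡ 𝟙 (i % 2 ≟ 1) * (𝟙 (j % 2 ≟ 1) * circlePoints c b i j)
  odd-only i j with circlePoints≡0⊎ c b i j
  ... | inj₁ points≡0 rewrite points≡0 = sym (trans (cong (𝟙 (i % 2 ≟ 1) *_) (*-zeroʳ (𝟙 (j % 2 ≟ 1)))) (*-zeroʳ (𝟙 (i % 2 ≟ 1))))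
  ... | inj₂ eq with x+y≡2⇒x≡1×y≡1 (m%n<n i 2) (m%n<n j 2) (trans (onCircle-parity {c} {b} {i} {j} eq) (cong (_+ 1) b-odd))
  ...   | i-odd , j-odd rewrite i-odd | j-odd = sym (trans (*-identityˡ _) (*-identityˡ _))

r2-even : ∀ c b → 1 ≤ c → b % 2 ≡ 0 → r2 (radius² c b) ≡ 2 * circlePointsWithParities c b 0 1
r2-even c b 1≤c b-even = begin
  r2 (radius² c b)
    ≡⟨ r2≡∑circlePoints c b 1≤c ⟩
  ∑[ i < b ] ∑[ j < b ] circlePoints c b i j
    ≡⟨ ∑-cong b (λ i _ → trans (∑-cong b (λ j _ → mixed-only i j)) (∑-distrib-+ b _ _)) ⟩
  ∑[ i < b ] (∑[ j < b ] P 0 1 i j + ∑[ j < b ] P 1 0 i j)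
    ≡⟨ ∑-distrib-+ b _ _ ⟩
  circlePointsWithParities c b 0 1 + circlePointsWithParities c b 1 0
    ≡⟨ cong (circlePointsWithParities c b 0 1 +_) (circlePointsWithParities-comm c b 1 0) ⟩
  circlePointsWithParities c b 0 1 + circlePointsWithParities c b 0 1
    ≡⟨ cong (circlePointsWithParities c b 0 1 +_) (+-identityʳ _) ⟨
  2 * circlePointsWithParities c b 0 1
    ∎
  where
  P : ℕ → ℕ → ℕ → ℕ → ℕ
  P p q i j = 𝟙 (i % 2 ≟ p) * (𝟙 (j % 2 ≟ q) * circlePoints c b i j)
  mixed-only : ∀ i j → circlePoints c b i j ≡ P 0 1 i j + P 1 0 i j
  mixed-only i j with circlePoints≡0⊎ c b i j
  ... | inj₁ points≡0 rewrite points≡0 = zeros (𝟙 (i % 2 ≟ 0)) (𝟙 (j % 2 ≟ 1)) (𝟙 (i % 2 ≟ 1)) (𝟙 (j % 2 ≟ 0))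
    where
    zeros : ∀ a b c d → 0 ≡ a * (b * 0) + c * (d * 0)
    zeros = solve-∀
  ... | inj₂ eq with x+y≡1⇒[x,y]≡[0,1]⊎[1,0] (m%n<n i 2) (m%n<n j 2) (trans (onCircle-parity {c} {b} {i} {j} eq) (cong (_+ 1) b-even))
  ...   | inj₁ (i-even , j-odd) rewrite i-even | j-odd = ones (circlePoints c b i j)
    where
    ones : ∀ x → x ≡ 1 * (1 * x) + 0
    ones = solve-∀
  ...   | inj₂ (i-odd , j-even) rewrite i-odd | j-even = sym (trans (*-identityˡ _) (*-identityˡ _))

∑-oddColumn : ∀ c n i → 1 ≤ c →
  ∑[ s < suc n ] onCircle c (2 + n) i (suc (s + s)) ≡ ∑[ j < 2 + n ] (𝟙 (j % 2 ≟ 1) * onCircle c (2 + n) i j)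
∑-oddColumn c n i 1≤c = trans (∑-odd (suc n) (onCircle c b i)) (∑-restrict _ support)
  where
  b = 2 + n
  support : ∀ j → 𝟙 (j % 2 ≟ 1) * onCircle c b i j ≡ 0 ⊎ (j < suc n + suc n × j < b)
  support j with 𝟙≡0⊎ (i * i + j * j + 4 * c ≟ b * b + 1)
  ... | inj₁ onCircle≡0 = inj₁ (trans (cong (𝟙 (j % 2 ≟ 1) *_) onCircle≡0) (*-zeroʳ (𝟙 (j % 2 ≟ 1))))
  ... | inj₂ eq = inj₂ (≤-trans j<b (s≤s (m≤n+m (suc n) n)) , j<b)
    where
    j<b : j < b
    j<b = proj₂ (onCircle-bounds {j = i} 1≤c (onCircle-swap c b i j eq))

twice-∑∑isFixedDigits : ∀ c n → 1 ≤ c →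
  2 * ∑[ u < suc n ] ∑[ s < suc n ] isFixedDigits c (2 + n) (suc u) (suc s) ≡
  circlePointsWithParities c (2 + n) (n % 2) 1
twice-∑∑isFixedDigits c n 1≤c = begin
  2 * ∑[ u < suc n ] ∑[ s < suc n ] isFixedDigits c b (suc u) (suc s)
    ≡⟨ cong (2 *_) (∑-cong (suc n) (λ u _ → ∑-cong (suc n) (λ s _ →
         trans (isFixedDigits≡onCircle c b (suc u) s)
               (cong (λ k → onCircle c b ∣ k - suc n ∣ (suc (s + s))) (+-suc u u))))) ⟩
  2 * ∑[ u < suc n ] ∑[ s < suc n ] onCircle c b ∣ u + u - n ∣ (suc (s + s))
    ≡⟨ cong (2 *_) (∑-cong (suc n) (λ u _ → ∑-oddColumn c n ∣ u + u - n ∣ 1≤c)) ⟩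
  2 * ∑[ u < suc n ] column ∣ u + u - n ∣
    ≡⟨ cong (2 *_) (∑-∣u+u-n∣ n column) ⟩
  2 * ∑[ i < b ] (𝟙 (i % 2 ≟ n % 2) * (abs⁻¹-size i * column i))
    ≡⟨ *-distribˡ-∑ b 2 (λ i → 𝟙 (i % 2 ≟ n % 2) * (abs⁻¹-size i * column i)) ⟩
  ∑[ i < b ] (2 * (𝟙 (i % 2 ≟ n % 2) * (abs⁻¹-size i * column i)))
    ≡⟨ ∑-cong b (λ i _ → row i) ⟩
  circlePointsWithParities c b (n % 2) 1
    ∎
  where
  b = 2 + n
  column : ℕ → ℕ
  column i = ∑[ j < b ] (𝟙 (j % 2 ≟ 1) * onCircle c b i j)
  row : ∀ i → 2 * (𝟙 (i % 2 ≟ n % 2) * (abs⁻¹-size i * column i)) ≡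
              ∑[ j < b ] (𝟙 (i % 2 ≟ n % 2) * (𝟙 (j % 2 ≟ 1) * circlePoints c b i j))
  row i = begin
    2 * (a * (w * column i))
      ≡⟨ pull-2 a w (column i) ⟩
    a * (w * (2 * column i))
      ≡⟨ cong (λ x → a * (w * x)) (*-distribˡ-∑ b 2 (λ j → 𝟙 (j % 2 ≟ 1) * onCircle c b i j)) ⟩
    a * (w * ∑[ j < b ] (2 * (𝟙 (j % 2 ≟ 1) * onCircle c b i j)))
      ≡⟨ cong (λ x → a * (w * x)) (∑-cong b (λ j _ → abs⁻¹-size-odd j (onCircle c b i j))) ⟩
    a * (w * ∑[ j < b ] (𝟙 (j % 2 ≟ 1) * (abs⁻¹-size j * onCircle c b i j)))
      ≡⟨ cong (a *_) (*-distribˡ-∑ b w (λ j → 𝟙 (j % 2 ≟ 1) * (abs⁻¹-size j * onCircle c b i j))) ⟩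
    a * ∑[ j < b ] (w * (𝟙 (j % 2 ≟ 1) * (abs⁻¹-size j * onCircle c b i j)))
      ≡⟨ *-distribˡ-∑ b a (λ j → w * (𝟙 (j % 2 ≟ 1) * (abs⁻¹-size j * onCircle c b i j))) ⟩
    ∑[ j < b ] (a * (w * (𝟙 (j % 2 ≟ 1) * (abs⁻¹-size j * onCircle c b i j))))
      ≡⟨ ∑-cong b (λ j _ → cong (a *_) (swap w (𝟙 (j % 2 ≟ 1)) (abs⁻¹-size j * onCircle c b i j))) ⟩
    ∑[ j < b ] (a * (𝟙 (j % 2 ≟ 1) * circlePoints c b i j))
      ∎
    where
    a = 𝟙 (i % 2 ≟ n % 2)
    w = abs⁻¹-size i
    pull-2 : ∀ x y z → 2 * (x * (y * z)) ≡ x * (y * (2 * z))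
    pull-2 = solve-∀
    swap : ∀ x y z → x * (y * z) ≡ y * (x * z)
    swap = solve-∀


open import Data.Integer using (+_)

theorem3p4 : (c b : ℕ) → 1 ≤ c → 2 ≤ b →
    ((b % 2 ≡ 1 → 2 * twoDigitFixedCount c b ≡ r2 (+ (b * b) ℤ.- + (4 * c) ℤ.+ + 1) + 2 * F1count c b)
    × (b % 2 ≡ 0 → 4 * twoDigitFixedCount c b ≡ r2 (+ (b * b) ℤ.- + (4 * c) ℤ.+ + 1) + 4 * F1count c b))
theorem3p4 c 1             _   (s≤s ())
theorem3p4 c (suc (suc n)) 1≤c _ = odd , even
  where
  b = 2 + n
  N = twoDigitFixedCount c b
  F = F1count c b
  D = ∑[ u < suc n ] ∑[ s < suc n ] isFixedDigits c b (suc u) (suc s)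
  R = r2 (radius² c b)
  N≡F+D : N ≡ F + D
  N≡F+D = twoDigitFixedCount≡F1count+∑ c n
  2D≡ : ∀ {p} → b % 2 ≡ p → 2 * D ≡ circlePointsWithParities c b p 1
  2D≡ refl = twice-∑∑isFixedDigits c n 1≤c
  odd : b % 2 ≡ 1 → 2 * N ≡ R + 2 * F
  odd b-odd = begin
    2 * N                                     ≡⟨ cong (2 *_) N≡F+D ⟩
    2 * (F + D)                               ≡⟨ *-distribˡ-+ 2 F D ⟩
    2 * F + 2 * D                             ≡⟨ cong (λ x → 2 * F + x) (2D≡ b-odd) ⟩
    2 * F + circlePointsWithParities c b 1 1  ≡⟨ cong (λ x → 2 * F + x) (r2-odd c b 1≤c b-odd) ⟨
    2 * F + R                                 ≡⟨ +-comm (2 * F) R ⟩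
    R + 2 * F                                 ∎
  even : b % 2 ≡ 0 → 4 * N ≡ R + 4 * F
  even b-even = begin
    4 * N                                         ≡⟨ cong (4 *_) N≡F+D ⟩
    4 * (F + D)                                   ≡⟨ regroup F D ⟩
    2 * (2 * D) + 4 * F                           ≡⟨ cong (λ x → 2 * x + 4 * F) (2D≡ b-even) ⟩
    2 * circlePointsWithParities c b 0 1 + 4 * F  ≡⟨ cong (_+ 4 * F) (r2-even c b 1≤c b-even) ⟨
    R + 4 * F                                     ∎
    where
    regroup : ∀ f d → 4 * (f + d) ≡ 2 * (2 * d) + 4 * f
    regroup = solve-∀
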